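{- Let $\mathcal L$ be a resource category which is closed with respect to $\otimes$ and canonically summable. Then for all objects $X,Y$ the morphism $\tilde\varphi_{X,Y}=\mathrm{cur}\big(S(\mathrm{ev})\circ\varphi'_{X\multimap Y,X}\big)\in\mathcal L(S(X\multimap Y),X\multimap SY)$ is an isomorphism.
   Context: $\mathcal L$ is a symmetric monoidal closed category (internal hom $\multimap$, evaluation $\mathrm{ev}\in\mathcal L((X\multimap Y)\otimes X,Y)$, currying $\mathrm{cur}$), enriched over pointed sets (zero morphisms absorbing for composition and tensor), cartesian, and equipped with a resource comonad $!$ with Seely isomorphisms (a model of linear logic in the sense of Seely). Canonical summability: with $I=1\& 1$, $S=I\multimap-$, $w_0=\langle\mathrm{id}_1,0\rangle$, $w_1=\langle0,\mathrm{id}_1\rangle$, $\Delta=\langle\mathrm{id}_1,\mathrm{id}_1\rangle$, $\bar\phi_X=\mathrm{ev}\circ((I\multimap X)\otimes\phi)\circ\rho^{ -1}$, $\pi_i=\bar w_i$ and $\sigma=\bar\Delta$, the tuple $(S,\pi_0,\pi_1,\sigma)$ is a summability structure: $\pi_0,\pi_1$ jointly monic; $f_0,f_1$ summable if there is a (unique) $\langle f_0,f_1\rangle_S$ with $\pi_i\langle f_0,f_1\rangle_S=f_i$, sum $f_0+f_1=\sigma\langle f_0,f_1\rangle_S$; (S-com) $\pi_1,\pi_0$ summable, $\sigma\langle\pi_1,\pi_0\rangle_S=\sigma$; (S-zero) $f,0$ summable, $f+0=f$; (S-witness) if $(f_{00},f_{01}),(f_{10},f_{11}),(f_{00}+f_{01},f_{10}+f_{11})$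 summable then $\langle f_{00},f_{01}\rangle_S,\langle f_{10},f_{11}\rangle_S$ summable; (S-assoc) $S\sigma_X c_X=\sigma_{SX}$ with $c_X$ the unique endomorphism of $S^2X$ with $\pi_{i,X}\pi_{j,SX}c_X=\pi_{j,X}\pi_{i,SX}$. In this situation $\pi_0\otimes X_1,\pi_1\otimes X_1\in\mathcal L(SX_0\otimes X_1,X_0\otimes X_1)$ are summable and $\varphi'_{X_0,X_1}=\langle\pi_0\otimes X_1,\pi_1\otimes X_1\rangle_S\in\mathcal L(SX_0\otimes X_1,S(X_0\otimes X_1))$. -}

module Defs where

open import Level using (Level; _⊔_) renaming (suc to lsuc)
open import Data.Bool using (Bool; false; true)
open import Data.Product using (Σ; _×_; _,_; proj₁)
open import Relation.Binary using (IsEquivalence)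

record ClosedResourceCategory (o ℓ e : Level) : Set (lsuc (o ⊔ ℓ ⊔ e)) where
  infixr 9 _∘_
  infix  4 _≈_
  infixr 10 _⊗₀_ _⊗₁_
  infixr 8 _⊸_
  infixr 11 _&_
  field
    Obj   : Set o
    Hom   : Obj → Obj → Set ℓ
    _≈_   : ∀ {A B} → Hom A B → Hom A B → Set e
    ≈-equiv : ∀ {A B} → IsEquivalence (_≈_ {A} {B})
    id    : ∀ {A} → Hom A A
    _∘_   : ∀ {A B C} → Hom B C → Hom A B → Hom A C
    assoc : ∀ {A B C D} {f : Hom A B} {g : Hom B C} {h : Hom C D} →
            (h ∘ g) ∘ f ≈ h ∘ (g ∘ f)
    identityˡ : ∀ {A B} {f : Hom A B} → id ∘ f ≈ f
    identityʳ : ∀ {A B} {f : Hom A B} → f ∘ id ≈ f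
    ∘-resp-≈  : ∀ {A B C} {f f' : Hom B C} {g g' : Hom A B} →
                f ≈ f' → g ≈ g' → f ∘ g ≈ f' ∘ g'

    𝟙     : Obj
    _⊗₀_  : Obj → Obj → Obj
    _⊗₁_  : ∀ {A B C D} → Hom A B → Hom C D → Hom (A ⊗₀ C) (B ⊗₀ D)
    ⊗-id  : ∀ {A B} → id {A} ⊗₁ id {B} ≈ id
    ⊗-∘   : ∀ {A B C D E F} {f : Hom A B} {g : Hom B C} {h : Hom D E} {k : Hom E F} →
            (g ∘ f) ⊗₁ (k ∘ h) ≈ (g ⊗₁ k) ∘ (f ⊗₁ h)
    ⊗-resp-≈ : ∀ {A B C D} {f f' : Hom A B} {g g' : Hom C D} →
               f ≈ f' → g ≈ g' → f ⊗₁ g ≈ f' ⊗₁ g'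
    λ⇒ : ∀ {A} → Hom (𝟙 ⊗₀ A) A
    λ⇐ : ∀ {A} → Hom A (𝟙 ⊗₀ A)
    λ-isoˡ : ∀ {A} → λ⇐ ∘ λ⇒ ≈ id {𝟙 ⊗₀ A}
    λ-isoʳ : ∀ {A} → λ⇒ ∘ λ⇐ ≈ id {A}
    λ-nat  : ∀ {A B} {f : Hom A B} → f ∘ λ⇒ ≈ λ⇒ ∘ (id ⊗₁ f)
    ρ⇒ : ∀ {A} → Hom (A ⊗₀ 𝟙) A
    ρ⇐ : ∀ {A} → Hom A (A ⊗₀ 𝟙)
    ρ-isoˡ : ∀ {A} → ρ⇐ ∘ ρ⇒ ≈ id {A ⊗₀ 𝟙}
    ρ-isoʳ : ∀ {A} → ρ⇒ ∘ ρ⇐ ≈ id {A}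
    ρ-nat  : ∀ {A B} {f : Hom A B} → f ∘ ρ⇒ ≈ ρ⇒ ∘ (f ⊗₁ id)
    α⇒ : ∀ {A B C} → Hom ((A ⊗₀ B) ⊗₀ C) (A ⊗₀ (B ⊗₀ C))
    α⇐ : ∀ {A B C} → Hom (A ⊗₀ (B ⊗₀ C)) ((A ⊗₀ B) ⊗₀ C)
    α-isoˡ : ∀ {A B C} → α⇐ ∘ α⇒ ≈ id {(A ⊗₀ B) ⊗₀ C}
    α-isoʳ : ∀ {A B C} → α⇒ ∘ α⇐ ≈ id {A ⊗₀ (B ⊗₀ C)}
    α-nat  : ∀ {A A' B B' C C'} {f : Hom A A'} {g : Hom B B'} {h : Hom C C'} →
             α⇒ ∘ ((f ⊗₁ g) ⊗₁ h) ≈ (f ⊗₁ (g ⊗₁ h)) ∘ α⇒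
    triangle : ∀ {A B} → (id {A} ⊗₁ λ⇒ {B}) ∘ α⇒ ≈ ρ⇒ ⊗₁ id
    pentagon : ∀ {A B C D} →
               (id {A} ⊗₁ α⇒ {B} {C} {D}) ∘ (α⇒ ∘ (α⇒ ⊗₁ id)) ≈ α⇒ ∘ α⇒
    γ     : ∀ {A B} → Hom (A ⊗₀ B) (B ⊗₀ A)
    γ-nat : ∀ {A A' B B'} {f : Hom A A'} {g : Hom B B'} →
            γ ∘ (f ⊗₁ g) ≈ (g ⊗₁ f) ∘ γ
    γ-γ   : ∀ {A B} → γ ∘ γ ≈ id {A ⊗₀ B}
    hexagon : ∀ {A B C} →
              α⇒ ∘ (γ ∘ α⇒) ≈ (id {B} ⊗₁ γ) ∘ (α⇒ ∘ (γ {A} ⊗₁ id {C}))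

    _⊸_ : Obj → Obj → Obj
    ev  : ∀ {A B} → Hom ((A ⊸ B) ⊗₀ A) B
    cur : ∀ {A B C} → Hom (C ⊗₀ A) B → Hom C (A ⊸ B)
    cur-resp-≈ : ∀ {A B C} {f f' : Hom (C ⊗₀ A) B} → f ≈ f' → cur f ≈ cur f'
    ev-cur : ∀ {A B C} {f : Hom (C ⊗₀ A) B} → ev ∘ (cur f ⊗₁ id) ≈ f
    cur-ev : ∀ {A B C} {g : Hom C (A ⊸ B)} → cur (ev ∘ (g ⊗₁ id)) ≈ g

    -- enrichment over pointed sets: zero morphisms absorbing for ∘ and ⊗
    0m   : ∀ {A B} → Hom A B
    0-∘ˡ : ∀ {A B C} {f : Hom B C} → f ∘ 0m {A} ≈ 0m
    0-∘ʳ : ∀ {A B C} {f : Hom A B} → 0m {B} {C} ∘ f ≈ 0m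
    0-⊗ˡ : ∀ {A B C D} {f : Hom C D} → 0m {A} {B} ⊗₁ f ≈ 0m
    0-⊗ʳ : ∀ {A B C D} {f : Hom A B} → f ⊗₁ 0m {C} {D} ≈ 0m

    ⊤    : Obj
    term : ∀ {A} → Hom A ⊤
    term-η : ∀ {A} {f : Hom A ⊤} → f ≈ term
    _&_  : Obj → Obj → Obj
    pr₁  : ∀ {A B} → Hom (A & B) A
    pr₂  : ∀ {A B} → Hom (A & B) B
    ⟨_,_⟩ : ∀ {A B C} → Hom C A → Hom C B → Hom C (A & B)
    pr₁-β : ∀ {A B C} {f : Hom C A} {g : Hom C B} → pr₁ ∘ ⟨ f , g ⟩ ≈ f
    pr₂-β : ∀ {A B C} {f : Hom C A} {g : Hom C B} → pr₂ ∘ ⟨ f , g ⟩ ≈ g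
    pair-η : ∀ {A B C} {h : Hom C (A & B)} → ⟨ pr₁ ∘ h , pr₂ ∘ h ⟩ ≈ h
    pair-resp-≈ : ∀ {A B C} {f f' : Hom C A} {g g' : Hom C B} →
                  f ≈ f' → g ≈ g' → ⟨ f , g ⟩ ≈ ⟨ f' , g' ⟩

    ！₀ : Obj → Obj
    ！₁ : ∀ {A B} → Hom A B → Hom (！₀ A) (！₀ B)
    ！-id : ∀ {A} → ！₁ (id {A}) ≈ id
    ！-∘  : ∀ {A B C} {f : Hom A B} {g : Hom B C} → ！₁ (g ∘ f) ≈ ！₁ g ∘ ！₁ f
    ！-resp-≈ : ∀ {A B} {f f' : Hom A B} → f ≈ f' → ！₁ f ≈ ！₁ f'
    der : ∀ {A} → Hom (！₀ A) A
    dig : ∀ {A} → Hom (！₀ A) (！₀ (！₀ A))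
    der-nat : ∀ {A B} {f : Hom A B} → der ∘ ！₁ f ≈ f ∘ der
    dig-nat : ∀ {A B} {f : Hom A B} → dig ∘ ！₁ f ≈ ！₁ (！₁ f) ∘ dig
    comonad-idˡ : ∀ {A} → der ∘ dig ≈ id {！₀ A}
    comonad-idʳ : ∀ {A} → ！₁ der ∘ dig ≈ id {！₀ A}
    comonad-assoc : ∀ {A} → dig ∘ dig ≈ ！₁ dig ∘ dig {A}

    -- Seely isomorphisms: ！ strong symmetric monoidal (L,&,⊤) → (L,⊗,𝟙),
    -- compatible with dig
    m0  : Hom 𝟙 (！₀ ⊤)
    m0⁻ : Hom (！₀ ⊤) 𝟙
    m0-isoˡ : m0⁻ ∘ m0 ≈ id
    m0-isoʳ : m0 ∘ m0⁻ ≈ id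
    m2  : ∀ {A B} → Hom (！₀ A ⊗₀ ！₀ B) (！₀ (A & B))
    m2⁻ : ∀ {A B} → Hom (！₀ (A & B)) (！₀ A ⊗₀ ！₀ B)
    m2-isoˡ : ∀ {A B} → m2⁻ ∘ m2 ≈ id {！₀ A ⊗₀ ！₀ B}
    m2-isoʳ : ∀ {A B} → m2 ∘ m2⁻ ≈ id {！₀ (A & B)}
    m2-nat  : ∀ {A A' B B'} {f : Hom A A'} {g : Hom B B'} →
              ！₁ ⟨ f ∘ pr₁ , g ∘ pr₂ ⟩ ∘ m2 ≈ m2 ∘ (！₁ f ⊗₁ ！₁ g)
    m2-assoc : ∀ {A B C} →
               ！₁ ⟨ pr₁ ∘ pr₁ , ⟨ pr₂ ∘ pr₁ , pr₂ ⟩ ⟩ ∘ (m2 ∘ (m2 {A} {B} ⊗₁ id {！₀ C}))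
               ≈ m2 ∘ ((id ⊗₁ m2) ∘ α⇒)
    m2-unitˡ : ∀ {A} → ！₁ pr₂ ∘ (m2 ∘ (m0 ⊗₁ id {！₀ A})) ≈ λ⇒
    m2-unitʳ : ∀ {A} → ！₁ pr₁ ∘ (m2 ∘ (id {！₀ A} ⊗₁ m0)) ≈ ρ⇒
    m2-sym   : ∀ {A B} → ！₁ ⟨ pr₂ , pr₁ ⟩ ∘ m2 {A} {B} ≈ m2 ∘ γ
    m2-dig   : ∀ {A B} →
               ！₁ ⟨ ！₁ pr₁ , ！₁ pr₂ ⟩ ∘ (dig ∘ m2 {A} {B}) ≈ m2 ∘ (dig ⊗₁ dig)

module Canonical {o ℓ e : Level} (L : ClosedResourceCategory o ℓ e) where
  open ClosedResourceCategory L

  I : Obj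
  I = 𝟙 & 𝟙

  S : Obj → Obj
  S X = I ⊸ X

  S₁ : ∀ {X Y} → Hom X Y → Hom (S X) (S Y)
  S₁ f = cur (f ∘ ev)

  w₀ w₁ Δ : Hom 𝟙 I
  w₀ = ⟨ id , 0m ⟩
  w₁ = ⟨ 0m , id ⟩
  Δ  = ⟨ id , id ⟩

  bar : ∀ {X} → Hom 𝟙 I → Hom (S X) X
  bar φ = ev ∘ ((id ⊗₁ φ) ∘ ρ⇐)

  π₀ π₁ σ : ∀ {X} → Hom (S X) X
  π₀ = bar w₀
  π₁ = bar w₁
  σ  = bar Δ

  π : Bool → ∀ {X} → Hom (S X) X
  π false = π₀
  π true  = π₁

  Witness : ∀ {X Y} → Hom X Y → Hom X Y → Hom X (S Y) → Set e
  Witness f₀ f₁ h = (π₀ ∘ h ≈ f₀) × (π₁ ∘ h ≈ f₁)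

  Summable : ∀ {X Y} → Hom X Y → Hom X Y → Set (ℓ ⊔ e)
  Summable {X} {Y} f₀ f₁ = Σ (Hom X (S Y)) (Witness f₀ f₁)

  sum : ∀ {X Y} {f₀ f₁ : Hom X Y} → Summable f₀ f₁ → Hom X Y
  sum s = σ ∘ proj₁ s

  witness : ∀ {X Y} {f₀ f₁ : Hom X Y} → Summable f₀ f₁ → Hom X (S Y)
  witness s = proj₁ s

  IsIso : ∀ {X Y} → Hom X Y → Set (ℓ ⊔ e)
  IsIso {X} {Y} f = Σ (Hom Y X) (λ g → (g ∘ f ≈ id) × (f ∘ g ≈ id))

record CanonicallySummable {o ℓ e : Level} (L : ClosedResourceCategory o ℓ e)
       : Set (o ⊔ ℓ ⊔ e) where
  open ClosedResourceCategory L
  open Canonical L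
  field
    jointly-monic : ∀ {X Y} (h h' : Hom X (S Y)) →
                    π₀ ∘ h ≈ π₀ ∘ h' → π₁ ∘ h ≈ π₁ ∘ h' → h ≈ h'
    S-com : ∀ {X} → Σ (Hom (S X) (S X)) (λ h → Witness π₁ π₀ h × (σ ∘ h ≈ σ))
    S-zero : ∀ {X Y} (f : Hom X Y) →
             Σ (Hom X (S Y)) (λ h → Witness f 0m h × (σ ∘ h ≈ f))
    S-witness : ∀ {X Y} {f₀₀ f₀₁ f₁₀ f₁₁ : Hom X Y}
                (s₀ : Summable f₀₀ f₀₁) (s₁ : Summable f₁₀ f₁₁) →
                Summable (sum s₀) (sum s₁) →
                Summable (witness s₀) (witness s₁)
    S-assoc : ∀ {X} (c : Hom (S (S X)) (S (S X))) →
              (∀ i j → π i ∘ (π j ∘ c) ≈ π j ∘ π i) →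
              S₁ σ ∘ c ≈ σ

{-# OPTIONS --safe #-}
module Submission where

-- The inverse of φ̃ is the exchange map X ⊸ (I ⊸ Y) → I ⊸ (X ⊸ Y), f ↦ λi.λx. f x i.
-- As π₀, π₁ are jointly monic, both composites may be tested after each projection
-- π_w = ev ∘ (id ⊗ w) ∘ ρ⁻¹. Now π_w ∘ exchange = X ⊸ π_w, and the witness property of φ'
-- says exactly that π_w commutes with the uncurried φ̃, i.e. π_w ∘ ev ∘ (φ̃ ⊗ X) = ev ∘ (π_w ⊗ X).

open import Level using (Level)
open import Data.Product using (_,_)
open import Relation.Binary using (IsEquivalence; Setoid)
import Relation.Binary.Reasoning.Setoid as SetoidReasoning
open import Defs

module Properties {o ℓ e : Level} (L : ClosedResourceCategory o ℓ e) where
  open ClosedResourceCategory L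
  open Canonical L

  module ≈ {A B : Obj} = IsEquivalence (≈-equiv {A} {B})

  homSetoid : Obj → Obj → Setoid ℓ e
  homSetoid A B = record { Carrier = Hom A B ; _≈_ = _≈_ ; isEquivalence = ≈-equiv }

  module HomReasoning {A B : Obj} = SetoidReasoning (homSetoid A B)
  open HomReasoning

  infixr 4 _⟩∘⟨_ refl⟩∘⟨_
  infixl 5 _⟩∘⟨refl

  _⟩∘⟨_ : ∀ {A B C} {f f' : Hom B C} {g g' : Hom A B} → f ≈ f' → g ≈ g' → f ∘ g ≈ f' ∘ g'
  _⟩∘⟨_ = ∘-resp-≈

  refl⟩∘⟨_ : ∀ {A B C} {f : Hom B C} {g g' : Hom A B} → g ≈ g' → f ∘ g ≈ f ∘ g'
  refl⟩∘⟨ eq = ≈.refl ⟩∘⟨ eq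

  _⟩∘⟨refl : ∀ {A B C} {f f' : Hom B C} {g : Hom A B} → f ≈ f' → f ∘ g ≈ f' ∘ g
  eq ⟩∘⟨refl = eq ⟩∘⟨ ≈.refl

  pullˡ : ∀ {A B C D} {a : Hom C D} {b : Hom B C} {c : Hom B D} {f : Hom A B} →
          a ∘ b ≈ c → a ∘ (b ∘ f) ≈ c ∘ f
  pullˡ eq = ≈.trans (≈.sym assoc) (eq ⟩∘⟨refl)

  pullʳ : ∀ {A B C D} {a : Hom B C} {b : Hom A B} {c : Hom A C} {f : Hom C D} →
          a ∘ b ≈ c → (f ∘ a) ∘ b ≈ f ∘ c
  pullʳ eq = ≈.trans assoc (refl⟩∘⟨ eq)

  retraction⇒monic : ∀ {A B C} {m : Hom B C} {r : Hom C B} {x y : Hom A B} →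
                     r ∘ m ≈ id → m ∘ x ≈ m ∘ y → x ≈ y
  retraction⇒monic {m = m} {r} {x} {y} rm≈id eq = begin
    x             ≈⟨ identityˡ ⟨
    id ∘ x        ≈⟨ pullˡ rm≈id ⟨
    r ∘ (m ∘ x)   ≈⟨ refl⟩∘⟨ eq ⟩
    r ∘ (m ∘ y)   ≈⟨ pullˡ rm≈id ⟩
    id ∘ y        ≈⟨ identityˡ ⟩
    y             ∎

  left-inverse≈right-inverse : ∀ {A B} {f f' : Hom A B} {l r : Hom B A} →
                               f ≈ f' → l ∘ f ≈ id → f' ∘ r ≈ id → l ≈ r
  left-inverse≈right-inverse {f = f} {f'} {l} {r} f≈f' lf≈id f'r≈id = begin
    l              ≈⟨ identityʳ ⟨
    l ∘ id         ≈⟨ refl⟩∘⟨ f'r≈id ⟨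
    l ∘ (f' ∘ r)   ≈⟨ refl⟩∘⟨ f≈f' ⟩∘⟨refl ⟨
    l ∘ (f ∘ r)    ≈⟨ pullˡ lf≈id ⟩
    id ∘ r         ≈⟨ identityˡ ⟩
    r              ∎

  inverse-square : ∀ {P Q P' Q'} {a : Hom P Q} {a' : Hom Q P} {b : Hom P' Q'} {b' : Hom Q' P'}
                   {x : Hom P P'} {y : Hom Q Q'} →
                   b ∘ x ≈ y ∘ a → a ∘ a' ≈ id → b' ∘ b ≈ id → b' ∘ y ≈ x ∘ a'
  inverse-square {a = a} {a'} {b} {b'} {x} {y} square aa'≈id b'b≈id = begin
    b' ∘ y               ≈⟨ refl⟩∘⟨ identityʳ ⟨
    b' ∘ (y ∘ id)        ≈⟨ refl⟩∘⟨ refl⟩∘⟨ aa'≈id ⟨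
    b' ∘ (y ∘ (a ∘ a'))  ≈⟨ refl⟩∘⟨ ≈.trans (pullˡ square) assoc ⟨
    b' ∘ (b ∘ (x ∘ a'))  ≈⟨ pullˡ b'b≈id ⟩
    id ∘ (x ∘ a')        ≈⟨ identityˡ ⟩
    x ∘ a'               ∎

  ⊗-∘ˡ : ∀ {A B C D} {f : Hom A B} {g : Hom B C} → (g ∘ f) ⊗₁ id {D} ≈ (g ⊗₁ id) ∘ (f ⊗₁ id)
  ⊗-∘ˡ = ≈.trans (⊗-resp-≈ ≈.refl (≈.sym identityˡ)) ⊗-∘

  ⊗-∘ʳ : ∀ {A B C D} {f : Hom A B} {g : Hom B C} → id {D} ⊗₁ (g ∘ f) ≈ (id ⊗₁ g) ∘ (id ⊗₁ f)
  ⊗-∘ʳ = ≈.trans (⊗-resp-≈ (≈.sym identityˡ) ≈.refl) ⊗-∘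

  ⊗-interchange : ∀ {A B C D} {f : Hom A B} {g : Hom C D} →
                  (id ⊗₁ g) ∘ (f ⊗₁ id) ≈ (f ⊗₁ id) ∘ (id ⊗₁ g)
  ⊗-interchange {f = f} {g} = begin
    (id ⊗₁ g) ∘ (f ⊗₁ id)  ≈⟨ ⊗-∘ ⟨
    (id ∘ f) ⊗₁ (g ∘ id)   ≈⟨ ⊗-resp-≈ (≈.trans identityˡ (≈.sym identityʳ))
                                       (≈.trans identityʳ (≈.sym identityˡ)) ⟩
    (f ∘ id) ⊗₁ (id ∘ g)   ≈⟨ ⊗-∘ ⟩
    (f ⊗₁ id) ∘ (id ⊗₁ g)  ∎

  ρ⇐-nat : ∀ {A B} {f : Hom A B} → ρ⇐ ∘ f ≈ (f ⊗₁ id) ∘ ρ⇐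
  ρ⇐-nat = inverse-square (≈.sym ρ-nat) ρ-isoʳ ρ-isoˡ

  α⇐-nat : ∀ {A A' B B' C C'} {f : Hom A A'} {g : Hom B B'} {h : Hom C C'} →
           α⇐ ∘ (f ⊗₁ (g ⊗₁ h)) ≈ ((f ⊗₁ g) ⊗₁ h) ∘ α⇐
  α⇐-nat = inverse-square α-nat α-isoʳ α-isoˡ

  -⊗𝟙-injective : ∀ {A B} {f g : Hom A B} → f ⊗₁ id {𝟙} ≈ g ⊗₁ id → f ≈ g
  -⊗𝟙-injective {f = f} {g} eq = begin
    f                       ≈⟨ identityʳ ⟨
    f ∘ id                  ≈⟨ refl⟩∘⟨ ρ-isoʳ ⟨
    f ∘ (ρ⇒ ∘ ρ⇐)           ≈⟨ pullˡ ρ-nat ⟩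
    (ρ⇒ ∘ (f ⊗₁ id)) ∘ ρ⇐   ≈⟨ (refl⟩∘⟨ eq) ⟩∘⟨refl ⟩
    (ρ⇒ ∘ (g ⊗₁ id)) ∘ ρ⇐   ≈⟨ pullˡ ρ-nat ⟨
    g ∘ (ρ⇒ ∘ ρ⇐)           ≈⟨ refl⟩∘⟨ ρ-isoʳ ⟩
    g ∘ id                  ≈⟨ identityʳ ⟩
    g                       ∎

  -- Kelly's coherence lemma: after α⇒ ∘ (- ⊗ 𝟙), both sides become
  -- (id ⊗ (id ⊗ λ⇒)) ∘ α⇒ ∘ α⇒, by the pentagon and the triangle respectively.
  ρ⇒-α⇒ : ∀ {A B} → (id {A} ⊗₁ ρ⇒ {B}) ∘ α⇒ ≈ ρ⇒ {A ⊗₀ B}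
  ρ⇒-α⇒ = -⊗𝟙-injective (retraction⇒monic α-isoˡ (≈.trans viaPentagon (≈.sym viaTriangle)))
    where
    viaPentagon : ∀ {A B} → α⇒ ∘ (((id {A} ⊗₁ ρ⇒ {B}) ∘ α⇒) ⊗₁ id {𝟙})
                            ≈ (id ⊗₁ (id ⊗₁ λ⇒)) ∘ (α⇒ ∘ α⇒)
    viaPentagon = begin
      α⇒ ∘ (((id ⊗₁ ρ⇒) ∘ α⇒) ⊗₁ id)                            ≈⟨ refl⟩∘⟨ ⊗-∘ˡ ⟩
      α⇒ ∘ (((id ⊗₁ ρ⇒) ⊗₁ id) ∘ (α⇒ ⊗₁ id))                    ≈⟨ pullˡ α-nat ⟩
      ((id ⊗₁ (ρ⇒ ⊗₁ id)) ∘ α⇒) ∘ (α⇒ ⊗₁ id)                    ≈⟨ pullʳ ≈.refl ⟩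
      (id ⊗₁ (ρ⇒ ⊗₁ id)) ∘ (α⇒ ∘ (α⇒ ⊗₁ id))                    ≈⟨ ⊗-resp-≈ ≈.refl triangle ⟩∘⟨refl ⟨
      (id ⊗₁ ((id ⊗₁ λ⇒) ∘ α⇒)) ∘ (α⇒ ∘ (α⇒ ⊗₁ id))             ≈⟨ ⊗-∘ʳ ⟩∘⟨refl ⟩
      ((id ⊗₁ (id ⊗₁ λ⇒)) ∘ (id ⊗₁ α⇒)) ∘ (α⇒ ∘ (α⇒ ⊗₁ id))    ≈⟨ pullʳ pentagon ⟩
      (id ⊗₁ (id ⊗₁ λ⇒)) ∘ (α⇒ ∘ α⇒)                            ∎
    viaTriangle : ∀ {A B} → α⇒ ∘ (ρ⇒ {A ⊗₀ B} ⊗₁ id {𝟙}) ≈ (id ⊗₁ (id ⊗₁ λ⇒)) ∘ (α⇒ ∘ α⇒)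
    viaTriangle = begin
      α⇒ ∘ (ρ⇒ ⊗₁ id)                     ≈⟨ refl⟩∘⟨ triangle ⟨
      α⇒ ∘ ((id ⊗₁ λ⇒) ∘ α⇒)              ≈⟨ refl⟩∘⟨ ⊗-resp-≈ ⊗-id ≈.refl ⟩∘⟨refl ⟨
      α⇒ ∘ (((id ⊗₁ id) ⊗₁ λ⇒) ∘ α⇒)      ≈⟨ pullˡ α-nat ⟩
      ((id ⊗₁ (id ⊗₁ λ⇒)) ∘ α⇒) ∘ α⇒      ≈⟨ assoc ⟩
      (id ⊗₁ (id ⊗₁ λ⇒)) ∘ (α⇒ ∘ α⇒)      ∎

  α⇐-ρ⇐ : ∀ {A B} → α⇐ ∘ (id {A} ⊗₁ ρ⇐ {B}) ≈ ρ⇐ {A ⊗₀ B}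
  α⇐-ρ⇐ = left-inverse≈right-inverse ρ⇒-α⇒ inverseˡ ρ-isoʳ
    where
    inverseˡ : ∀ {A B} → (α⇐ ∘ (id {A} ⊗₁ ρ⇐ {B})) ∘ ((id ⊗₁ ρ⇒) ∘ α⇒) ≈ id
    inverseˡ = begin
      (α⇐ ∘ (id ⊗₁ ρ⇐)) ∘ ((id ⊗₁ ρ⇒) ∘ α⇒)  ≈⟨ pullʳ (pullˡ (≈.sym ⊗-∘ʳ)) ⟩
      α⇐ ∘ ((id ⊗₁ (ρ⇐ ∘ ρ⇒)) ∘ α⇒)          ≈⟨ refl⟩∘⟨ ≈.trans (⊗-resp-≈ ≈.refl ρ-isoˡ) ⊗-id ⟩∘⟨refl ⟩
      α⇐ ∘ (id ∘ α⇒)                          ≈⟨ refl⟩∘⟨ identityˡ ⟩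
      α⇐ ∘ α⇒                                 ≈⟨ α-isoˡ ⟩
      id                                      ∎

  cur-unique : ∀ {A B C} {f : Hom (C ⊗₀ A) B} {g : Hom C (A ⊸ B)} → ev ∘ (g ⊗₁ id) ≈ f → g ≈ cur f
  cur-unique eq = ≈.trans (≈.sym cur-ev) (cur-resp-≈ eq)

  cur-∘ : ∀ {A B C D} {f : Hom (C ⊗₀ A) B} {h : Hom D C} → cur f ∘ h ≈ cur (f ∘ (h ⊗₁ id))
  cur-∘ = cur-unique (≈.trans (refl⟩∘⟨ ⊗-∘ˡ) (pullˡ ev-cur))

  id≈cur-ev : ∀ {A B} → id ≈ cur (ev {A} {B})
  id≈cur-ev = cur-unique (≈.trans (refl⟩∘⟨ ⊗-id) identityʳ)

  -- bar w is definitionally ev ∘ insert w.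
  insert : ∀ {A J} → Hom 𝟙 J → Hom A (A ⊗₀ J)
  insert w = (id ⊗₁ w) ∘ ρ⇐

  insert-nat : ∀ {A B J} {w : Hom 𝟙 J} {f : Hom A B} → insert w ∘ f ≈ (f ⊗₁ id) ∘ insert w
  insert-nat = ≈.trans (pullʳ ρ⇐-nat) (≈.trans (pullˡ ⊗-interchange) assoc)

  α⇐-insert : ∀ {A B J} {w : Hom 𝟙 J} → α⇐ ∘ (id {A} ⊗₁ insert {B} w) ≈ insert w
  α⇐-insert {w = w} = begin
    α⇐ ∘ (id ⊗₁ ((id ⊗₁ w) ∘ ρ⇐))              ≈⟨ refl⟩∘⟨ ⊗-∘ʳ ⟩
    α⇐ ∘ ((id ⊗₁ (id ⊗₁ w)) ∘ (id ⊗₁ ρ⇐))      ≈⟨ pullˡ α⇐-nat ⟩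
    (((id ⊗₁ id) ⊗₁ w) ∘ α⇐) ∘ (id ⊗₁ ρ⇐)      ≈⟨ pullʳ α⇐-ρ⇐ ⟩
    ((id ⊗₁ id) ⊗₁ w) ∘ ρ⇐                     ≈⟨ ⊗-resp-≈ ⊗-id ≈.refl ⟩∘⟨refl ⟩
    (id ⊗₁ w) ∘ ρ⇐                             ∎

  bar-cur : ∀ {C Z} (w : Hom 𝟙 I) {g : Hom (C ⊗₀ I) Z} → bar w ∘ cur g ≈ g ∘ insert w
  bar-cur w = ≈.trans (pullʳ insert-nat) (pullˡ ev-cur)

  bar-S₁ : ∀ {A B} (w : Hom 𝟙 I) {f : Hom A B} → bar w ∘ S₁ f ≈ f ∘ bar w
  bar-S₁ w = ≈.trans (bar-cur w) assoc

  exchange : ∀ {X Y} → Hom (X ⊸ S Y) (S (X ⊸ Y))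
  exchange = cur (cur (ev ∘ (((ev ∘ γ) ⊗₁ id) ∘ (α⇐ ∘ γ))))

  bar-exchange : ∀ {X Y} (w : Hom 𝟙 I) → bar w ∘ exchange {X} {Y} ≈ cur (bar w ∘ ev)
  bar-exchange {X} {Y} w = ≈.trans (bar-cur w) (≈.trans cur-∘ (cur-resp-≈ uncurried))
    where
    uncurried : (ev ∘ (((ev ∘ γ) ⊗₁ id) ∘ (α⇐ ∘ γ))) ∘ (insert w ⊗₁ id) ≈ bar w ∘ ev {X} {S Y}
    uncurried = begin
      (ev ∘ (((ev ∘ γ) ⊗₁ id) ∘ (α⇐ ∘ γ))) ∘ (insert w ⊗₁ id)  ≈⟨ pullʳ (pullʳ (pullʳ γ-nat)) ⟩
      ev ∘ (((ev ∘ γ) ⊗₁ id) ∘ (α⇐ ∘ ((id ⊗₁ insert w) ∘ γ)))  ≈⟨ refl⟩∘⟨ refl⟩∘⟨ pullˡ α⇐-insert ⟩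
      ev ∘ (((ev ∘ γ) ⊗₁ id) ∘ (insert w ∘ γ))                 ≈⟨ refl⟩∘⟨ ≈.trans (pullˡ insert-nat) assoc ⟨
      ev ∘ (insert w ∘ ((ev ∘ γ) ∘ γ))                         ≈⟨ refl⟩∘⟨ refl⟩∘⟨ pullʳ γ-γ ⟩
      ev ∘ (insert w ∘ (ev ∘ id))                              ≈⟨ refl⟩∘⟨ refl⟩∘⟨ identityʳ ⟩
      ev ∘ (insert w ∘ ev)                                     ≈⟨ assoc ⟨
      bar w ∘ ev                                               ∎

  module _ {X Y : Obj} {g : Hom (S (X ⊸ Y)) (X ⊸ S Y)} (w : Hom 𝟙 I)
           (g-bar : bar w ∘ (ev ∘ (g ⊗₁ id)) ≈ ev ∘ (bar w ⊗₁ id)) where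

    bar-exchange-∘ : bar w ∘ (exchange ∘ g) ≈ bar w ∘ id
    bar-exchange-∘ = begin
      bar w ∘ (exchange ∘ g)          ≈⟨ pullˡ (bar-exchange w) ⟩
      cur (bar w ∘ ev) ∘ g            ≈⟨ cur-∘ ⟩
      cur ((bar w ∘ ev) ∘ (g ⊗₁ id))  ≈⟨ cur-resp-≈ (≈.trans assoc g-bar) ⟩
      cur (ev ∘ (bar w ⊗₁ id))        ≈⟨ cur-ev ⟩
      bar w                           ≈⟨ identityʳ ⟨
      bar w ∘ id                      ∎

    bar-ev-∘-exchange : bar w ∘ (ev ∘ ((g ∘ exchange) ⊗₁ id)) ≈ bar w ∘ ev
    bar-ev-∘-exchange = begin
      bar w ∘ (ev ∘ ((g ∘ exchange) ⊗₁ id))            ≈⟨ refl⟩∘⟨ refl⟩∘⟨ ⊗-∘ˡ ⟩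
      bar w ∘ (ev ∘ ((g ⊗₁ id) ∘ (exchange ⊗₁ id)))    ≈⟨ refl⟩∘⟨ assoc ⟨
      bar w ∘ ((ev ∘ (g ⊗₁ id)) ∘ (exchange ⊗₁ id))    ≈⟨ pullˡ g-bar ⟩
      (ev ∘ (bar w ⊗₁ id)) ∘ (exchange ⊗₁ id)          ≈⟨ pullʳ (≈.sym ⊗-∘ˡ) ⟩
      ev ∘ ((bar w ∘ exchange) ⊗₁ id)                  ≈⟨ refl⟩∘⟨ ⊗-resp-≈ (bar-exchange w) ≈.refl ⟩
      ev ∘ (cur (bar w ∘ ev) ⊗₁ id)                    ≈⟨ ev-cur ⟩
      bar w ∘ ev                                       ∎

  module _ (CS : CanonicallySummable L) where
    open CanonicallySummable CS using (jointly-monic)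

    π-commuting-uncurry⇒IsIso : ∀ {X Y} {g : Hom (S (X ⊸ Y)) (X ⊸ S Y)} →
                                π₀ ∘ (ev ∘ (g ⊗₁ id)) ≈ ev ∘ (π₀ ⊗₁ id) →
                                π₁ ∘ (ev ∘ (g ⊗₁ id)) ≈ ev ∘ (π₁ ⊗₁ id) →
                                IsIso g
    π-commuting-uncurry⇒IsIso {g = g} g-π₀ g-π₁ = exchange , exchange∘g≈id , g∘exchange≈id
      where
      exchange∘g≈id : exchange ∘ g ≈ id
      exchange∘g≈id = jointly-monic _ _ (bar-exchange-∘ w₀ g-π₀) (bar-exchange-∘ w₁ g-π₁)
      g∘exchange≈id : g ∘ exchange ≈ id
      g∘exchange≈id = begin
        g ∘ exchange  ≈⟨ cur-unique (jointly-monic _ _ (bar-ev-∘-exchange w₀ g-π₀)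
                                                       (bar-ev-∘-exchange w₁ g-π₁)) ⟩
        cur ev        ≈⟨ id≈cur-ev ⟨
        id            ∎

mainTheorem15 : ∀ {o ℓ e : Level} (L : ClosedResourceCategory o ℓ e) →
    CanonicallySummable L →
    let open ClosedResourceCategory L
        open Canonical L
    in ∀ (X Y : Obj) (φ' : Hom (S (X ⊸ Y) ⊗₀ X) (S ((X ⊸ Y) ⊗₀ X))) →
       Witness (π₀ ⊗₁ id) (π₁ ⊗₁ id) φ' →
       IsIso (cur (S₁ ev ∘ φ'))
mainTheorem15 L CS X Y φ' (φ'-π₀ , φ'-π₁) =
  π-commuting-uncurry⇒IsIso CS (π-commutes w₀ φ'-π₀) (π-commutes w₁ φ'-π₁)
  where
  open ClosedResourceCategory L
  open Canonical L
  open Properties L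
  open HomReasoning

  π-commutes : ∀ w → bar w ∘ φ' ≈ bar w ⊗₁ id →
               bar w ∘ (ev ∘ (cur (S₁ ev ∘ φ') ⊗₁ id)) ≈ ev ∘ (bar w ⊗₁ id)
  π-commutes w φ'-w = begin
    bar w ∘ (ev ∘ (cur (S₁ ev ∘ φ') ⊗₁ id))  ≈⟨ refl⟩∘⟨ ev-cur ⟩
    bar w ∘ (S₁ ev ∘ φ')                     ≈⟨ pullˡ (bar-S₁ w) ⟩
    (ev ∘ bar w) ∘ φ'                        ≈⟨ pullʳ φ'-w ⟩
    ev ∘ (bar w ⊗₁ id)                       ∎
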